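{- Let $(\mathcal C,I,0,1,\Omega_{\mathrm{cof}})$ be an ABCHFL setup. Then for every pair of distinct points $r\neq s\colon1\to I\times I$, the tuple $(\mathcal C,I\times I,r,s,\Omega_{\mathrm{cof}})$ is an ABCHFL setup. Moreover, the class of $(I\times I,\Omega_{\mathrm{cof}})$-fibrations coincides with the class of $(I,\Omega_{\mathrm{cof}})$-fibrations.
   Context: An ABCHFL setup $(\mathcal C,I,0,1,\Omega_{\mathrm{cof}})$ consists of a small category $\mathcal C$ with finite products, a representable presheaf $I\in\widehat{\mathcal C}$ with distinct points $0,1\colon1\to I$, and a subobject $\Omega_{\mathrm{cof}}\rightarrowtail\Omega_{\mathrm{dec}}$ of the classifier $\Omega_{\mathrm{dec}}$ of levelwise decidable subobjects in $\widehat{\mathcal C}$, such that $\Omega_{\mathrm{cof}}$ classifies the diagonal $I\to I\times I$ and is closed under finite conjunction, finite disjunction, and universal quantification over $I$. (Monomorphisms classified by $\Omega_{\mathrm{cof}}$ are called cofibrations.) Given a monomorphism $m\colon A\rightarrowtail B$ classified by $\Omega_{\mathrm{cof}}$ and a map $z\colon B\to J$ (where $J$ is the interval object in question), let $m\otimes z\colon B\sqcup_A(A\times J)\to B\times J$ be the map out of the pushout of $B\xleftarrow{m}A\xrightarrow{(\mathrm{id},zm)}A\times J$ induced by $(\mathrm{id},z)\colon B\to B\times J$ and $m\times J\colon A\times J\to B\times J$. A map $f\colon Y\to X$ in $\widehat{\mathcal C}$ is a $(J,\Omega_{\mathrm{cof}})$-fibration if it has the right lifting property against $m\otimes z$ for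 every such $m$ and every $z\colon B\to J$. -}

module Defs where

open import Level using (Level; 0ℓ)
open import Data.Bool using (Bool; true; false; _∧_; _∨_)
open import Data.Unit using (⊤; tt)
open import Data.Empty using (⊥; ⊥-elim)
open import Data.Product using (Σ; Σ-syntax; _×_; _,_; proj₁; proj₂)
open import Relation.Nullary using (¬_; Dec; yes; no)
open import Relation.Binary.PropositionalEquality
  using (_≡_; refl; sym; trans; cong; cong₂; subst)

record Category : Set₁ where
  infixr 9 _∘_
  field
    Ob  : Set
    Hom : Ob → Ob → Set
    id  : ∀ {a} → Hom a a
    _∘_ : ∀ {a b c} → Hom b c → Hom a b → Hom a c
    identityˡ : ∀ {a b} (f : Hom a b) → id ∘ f ≡ f
    identityʳ : ∀ {a b} (f : Hom a b) → f ∘ id ≡ f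
    assoc : ∀ {a b c d} (f : Hom c d) (g : Hom b c) (h : Hom a b) →
            (f ∘ g) ∘ h ≡ f ∘ (g ∘ h)

record FiniteProducts (C : Category) : Set where
  open Category C
  field
    terminal : Ob
    ! : ∀ {a} → Hom a terminal
    !-unique : ∀ {a} (f : Hom a terminal) → f ≡ !
    _×ₒ_ : Ob → Ob → Ob
    π₁ : ∀ {a b} → Hom (a ×ₒ b) a
    π₂ : ∀ {a b} → Hom (a ×ₒ b) b
    ⟨_,_⟩ : ∀ {a b c} → Hom c a → Hom c b → Hom c (a ×ₒ b)
    π₁-β : ∀ {a b c} (f : Hom c a) (g : Hom c b) → π₁ ∘ ⟨ f , g ⟩ ≡ f
    π₂-β : ∀ {a b c} (f : Hom c a) (g : Hom c b) → π₂ ∘ ⟨ f , g ⟩ ≡ g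
    ⟨⟩-unique : ∀ {a b c} (f : Hom c a) (g : Hom c b) (h : Hom c (a ×ₒ b)) →
                π₁ ∘ h ≡ f → π₂ ∘ h ≡ g → h ≡ ⟨ f , g ⟩

module _ {C : Category} where
  open Category C

  record Presheaf : Set₁ where
    field
      F₀ : Ob → Set
      F₁ : ∀ {a b} → Hom a b → F₀ b → F₀ a
      F-id : ∀ {a} (x : F₀ a) → F₁ id x ≡ x
      F-∘ : ∀ {a b c} (f : Hom b c) (g : Hom a b) (x : F₀ c) →
            F₁ (f ∘ g) x ≡ F₁ g (F₁ f x)
  open Presheaf public

  record Nat (F G : Presheaf) : Set where
    field
      η : ∀ c → F₀ F c → F₀ G c
      natural : ∀ {a b} (f : Hom a b) (x : F₀ F b) →
                η a (F₁ F f x) ≡ F₁ G f (η b x)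
  open Nat public

  infix 4 _≈N_
  _≈N_ : {F G : Presheaf} → Nat F G → Nat F G → Set
  α ≈N β = ∀ c x → η α c x ≡ η β c x

  idN : {F : Presheaf} → Nat F F
  idN = record { η = λ c x → x ; natural = λ f x → refl }

  infixr 9 _∘N_
  _∘N_ : {F G H : Presheaf} → Nat G H → Nat F G → Nat F H
  _∘N_ {F} {G} {H} α β = record
    { η = λ c x → η α c (η β c x)
    ; natural = λ {a} {b} f x →
        trans (cong (η α a) (natural β f x)) (natural α f (η β b x)) }

  𝟏P : Presheaf
  𝟏P = record { F₀ = λ _ → ⊤ ; F₁ = λ _ x → x ; F-id = λ _ → refl ; F-∘ = λ _ _ _ → refl }

  infixr 2 _×P_
  _×P_ : Presheaf → Presheaf → Presheaf
  F ×P G = record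
    { F₀ = λ c → F₀ F c × F₀ G c
    ; F₁ = λ f p → F₁ F f (proj₁ p) , F₁ G f (proj₂ p)
    ; F-id = λ p → cong₂ _,_ (F-id F (proj₁ p)) (F-id G (proj₂ p))
    ; F-∘ = λ f g p → cong₂ _,_ (F-∘ F f g (proj₁ p)) (F-∘ G f g (proj₂ p)) }

  π₁N : {F G : Presheaf} → Nat (F ×P G) F
  π₁N = record { η = λ c p → proj₁ p ; natural = λ f p → refl }

  π₂N : {F G : Presheaf} → Nat (F ×P G) G
  π₂N = record { η = λ c p → proj₂ p ; natural = λ f p → refl }

  ⟨_,_⟩N : {H F G : Presheaf} → Nat H F → Nat H G → Nat H (F ×P G)
  ⟨ α , β ⟩N = record
    { η = λ c x → η α c x , η β c x
    ; natural = λ f x → cong₂ _,_ (natural α f x) (natural β f x) }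

  infixr 3 _×N_
  _×N_ : {F F' G G' : Presheaf} → Nat F F' → Nat G G' → Nat (F ×P G) (F' ×P G')
  α ×N β = ⟨ α ∘N π₁N , β ∘N π₂N ⟩N

  diag : (J : Presheaf) → Nat J (J ×P J)
  diag J = ⟨ idN , idN ⟩N

  Point : Presheaf → Set
  Point J = Nat 𝟏P J

  y : Ob → Presheaf
  y c = record
    { F₀ = λ d → Hom d c
    ; F₁ = λ f g → g ∘ f
    ; F-id = identityʳ
    ; F-∘ = λ f g x → sym (assoc x f g) }

  record Iso (F G : Presheaf) : Set where
    field
      to   : Nat F G
      from : Nat G F
      to∘from : (to ∘N from) ≈N idN
      from∘to : (from ∘N to) ≈N idN

  Representable : Presheaf → Set
  Representable F = Σ[ c ∈ Ob ] Iso (y c) F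

  -- Levelwise decidable subobjects and their classifier Ω_dec.
  -- An element of Ω_dec(c) is a decidable sieve on c.

  record DecSieve (c : Ob) : Set where
    field
      mem : ∀ {d} → Hom d c → Bool
      closed : ∀ {d e} (f : Hom d c) (g : Hom e d) →
               mem f ≡ true → mem (f ∘ g) ≡ true
  open DecSieve public

  infix 4 _≈S_
  _≈S_ : ∀ {c} → DecSieve c → DecSieve c → Set
  S ≈S T = ∀ {d} (f : Hom d _) → mem S f ≡ mem T f

  restrict : ∀ {c d} → Hom d c → DecSieve c → DecSieve d
  restrict h S = record
    { mem = λ f → mem S (h ∘ f)
    ; closed = λ f g p →
        subst (λ k → mem S k ≡ true) (assoc h f g)
              (closed S (h ∘ f) g p) }

  IsMaximal : ∀ {c} → DecSieve c → Set
  IsMaximal S = mem S id ≡ true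

  private
    ∧-closed : ∀ {a b a' b'} → (a ≡ true → a' ≡ true) → (b ≡ true → b' ≡ true) →
               a ∧ b ≡ true → a' ∧ b' ≡ true
    ∧-closed {true} {true} p q r = subst (λ z → z ∧ _ ≡ true) (sym (p refl)) (q refl)
    ∧-closed {true} {false} p q ()
    ∧-closed {false} p q ()

    ∨-closed : ∀ {a b a' b'} → (a ≡ true → a' ≡ true) → (b ≡ true → b' ≡ true) →
               a ∨ b ≡ true → a' ∨ b' ≡ true
    ∨-closed {true} p q r rewrite p refl = refl
    ∨-closed {false} {true} {a'} p q r rewrite q refl with a'
    ... | true = refl
    ... | false = refl
    ∨-closed {false} {false} p q ()

  ⊤S : ∀ c → DecSieve c
  ⊤S c = record { mem = λ _ → true ; closed = λ _ _ _ → refl }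

  ⊥S : ∀ c → DecSieve c
  ⊥S c = record { mem = λ _ → false ; closed = λ _ _ p → p }

  _∧S_ : ∀ {c} → DecSieve c → DecSieve c → DecSieve c
  S ∧S T = record
    { mem = λ f → mem S f ∧ mem T f
    ; closed = λ f g → ∧-closed (closed S f g) (closed T f g) }

  _∨S_ : ∀ {c} → DecSieve c → DecSieve c → DecSieve c
  S ∨S T = record
    { mem = λ f → mem S f ∨ mem T f
    ; closed = λ f g → ∨-closed (closed S f g) (closed T f g) }

  -- Ω_cof : a subobject (subpresheaf) of Ω_dec
  record CofStructure : Set₁ where
    field
      Cof : ∀ c → DecSieve c → Set
      Cof-resp : ∀ {c} {S T : DecSieve c} → S ≈S T → Cof c S → Cof c T
      Cof-restrict : ∀ {c d} (h : Hom d c) (S : DecSieve c) →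
                     Cof c S → Cof d (restrict h S)
  open CofStructure public

  Monic : {A B : Presheaf} → Nat A B → Set
  Monic {A} {B} m = ∀ c (x x' : F₀ A c) → η m c x ≡ η m c x' → x ≡ x'

  InImage : {A B : Presheaf} → Nat A B → ∀ c → F₀ B c → Set
  InImage {A} m c b = Σ[ a ∈ F₀ A c ] η m c a ≡ b

  LevelwiseDecidable : {A B : Presheaf} → Nat A B → Set
  LevelwiseDecidable {A} {B} m = ∀ c (b : F₀ B c) → Dec (InImage m c b)

  private
    isYes : ∀ {P : Set} → Dec P → Bool
    isYes (yes _) = true
    isYes (no _) = false

    fromYes : ∀ {P : Set} (d : Dec P) → isYes d ≡ true → P
    fromYes (yes p) _ = p
    fromYes (no _) ()

    toYes : ∀ {P : Set} (d : Dec P) → P → isYes d ≡ true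
    toYes (yes _) _ = refl
    toYes (no ¬p) p = ⊥-elim (¬p p)

  χ : {A B : Presheaf} (m : Nat A B) → LevelwiseDecidable m →
      ∀ {c} → F₀ B c → DecSieve c
  χ {A} {B} m dec {c} b = record
    { mem = λ {d} f → isYes (dec d (F₁ B f b))
    ; closed = λ {d} {e} f g p →
        let w = fromYes (dec d (F₁ B f b)) p in
        toYes (dec e (F₁ B (f ∘ g) b))
          ( F₁ A g (proj₁ w)
          , trans (natural m g (proj₁ w))
              (trans (cong (F₁ B g) (proj₂ w)) (sym (F-∘ B f g b))) ) }

  record IsCofibration (Ω : CofStructure) {A B : Presheaf} (m : Nat A B) : Set where
    field
      monic : Monic m
      decidable : LevelwiseDecidable m
      classified : ∀ c (b : F₀ B c) → Cof Ω c (χ m decidable b)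

  -- Universal quantification over J on Ω_dec, restricted to Ω_cof.
  -- An element of Ω_cof^J at stage c is a natural map y c × J → Ω_cof.

  record CofFamily (Ω : CofStructure) (J : Presheaf) (c : Ob) : Set where
    field
      φ : ∀ {e} → Hom e c → F₀ J e → DecSieve e
      φ-natural : ∀ {e e'} (h : Hom e' e) (g : Hom e c) (x : F₀ J e) →
                  φ (g ∘ h) (F₁ J h x) ≈S restrict h (φ g x)
      φ-cof : ∀ {e} (g : Hom e c) (x : F₀ J e) → Cof Ω e (φ g x)
  open CofFamily public

  IsForall : ∀ {Ω J c} → CofFamily Ω J c → DecSieve c → Set
  IsForall {Ω} {J} {c} Φ S =
    ∀ {d} (f : Hom d c) →
      (mem S f ≡ true → ∀ {e} (g : Hom e d) (x : F₀ J e) → IsMaximal (φ Φ (f ∘ g) x))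
    × ((∀ {e} (g : Hom e d) (x : F₀ J e) → IsMaximal (φ Φ (f ∘ g) x)) → mem S f ≡ true)

  -- (J, Ω_cof)-fibrations: right lifting against m ⊗ z.
  -- A map out of the pushout B ⊔_A (A × J) is a compatible pair (u , v).

  IsFibration : (J : Presheaf) (Ω : CofStructure) {Y X : Presheaf} → Nat Y X → Set₁
  IsFibration J Ω {Y} {X} f =
    ∀ (A B : Presheaf) (m : Nat A B) → IsCofibration Ω m → (z : Nat B J) →
    (u : Nat B Y) (v : Nat (A ×P J) Y) →
    (u ∘N m) ≈N (v ∘N ⟨ idN , z ∘N m ⟩N) →
    (w : Nat (B ×P J) X) →
    (f ∘N u) ≈N (w ∘N ⟨ idN , z ⟩N) →
    (f ∘N v) ≈N (w ∘N (m ×N idN)) →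
    Σ[ ℓ ∈ Nat (B ×P J) Y ]
      ((f ∘N ℓ) ≈N w) × ((ℓ ∘N ⟨ idN , z ⟩N) ≈N u) × ((ℓ ∘N (m ×N idN)) ≈N v)

record IsABCHFLSetup (C : Category) (fp : FiniteProducts C)
                     (I : Presheaf {C}) (p₀ p₁ : Point I)
                     (Ω : CofStructure {C}) : Set₁ where
  open Category C
  field
    representable : Representable I
    distinct : ¬ (p₀ ≈N p₁)
    diagonal-cof : IsCofibration Ω (diag I)
    ⊤-cof : ∀ c → Cof Ω c (⊤S c)
    ∧-cof : ∀ c (S T : DecSieve c) → Cof Ω c S → Cof Ω c T → Cof Ω c (S ∧S T)
    ⊥-cof : ∀ c → Cof Ω c (⊥S c)
    ∨-cof : ∀ c (S T : DecSieve c) → Cof Ω c S → Cof Ω c T → Cof Ω c (S ∨S T)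
    ∀-cof : ∀ c (Φ : CofFamily Ω I c) →
            Σ[ S ∈ DecSieve c ] (IsForall Φ S × Cof Ω c S)

{-# OPTIONS --safe #-}

-- All the setup axioms for I × I reduce to those for I: the Yoneda embedding
-- preserves products, the diagonal of a product is the conjunction of the two
-- diagonals, and quantifying over I × I is quantifying over I twice.  As for
-- fibrations, lifting against m ⊗ (z₁ , z₂) splits into a lift against m ⊗ z₂
-- followed by one against (m × I) ⊗ z₁; conversely m ⊗ z is a retract of
-- m ⊗ (z , z) through the diagonal I → I × I.
module Submission where

open import Defs
open import Data.Bool using (true; _∧_)
open import Data.Bool.Properties using (⇔→≡; ∧-conicalˡ; ∧-conicalʳ)
open import Data.Product using (_×_; Σ-syntax; _,_; proj₁; proj₂)
open import Data.Product.Properties using (,-injectiveˡ; ,-injectiveʳ)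
open import Data.Product.Function.NonDependent.Propositional using (_×-⇔_)
open import Function.Bundles using (_⇔_; mk⇔; module Equivalence)
import Function.Properties.Equivalence as ⇔
open import Relation.Nullary using (¬_; yes; no; contradiction)
open import Relation.Nullary.Decidable using (_×-dec_)
import Relation.Nullary.Decidable as Dec
open import Relation.Binary.PropositionalEquality
  using (_≡_; refl; sym; trans; cong; cong₂)

module _ {C : Category} where
  open Category C

  private variable
    c c' d e : Ob
    A A' B B' J K P : Presheaf {C}
    Ω : CofStructure {C}

  Iso-trans : Iso A B → Iso B P → Iso A P
  Iso-trans i j = record
    { to = Iso.to j ∘N Iso.to i
    ; from = Iso.from i ∘N Iso.from j
    ; to∘from = λ c x →
        trans (cong (η (Iso.to j) c) (Iso.to∘from i c (η (Iso.from j) c x)))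
              (Iso.to∘from j c x)
    ; from∘to = λ c x →
        trans (cong (η (Iso.from i) c) (Iso.from∘to j c (η (Iso.to i) c x)))
              (Iso.from∘to i c x)
    }

  Iso-×P : Iso A B → Iso A' B' → Iso (A ×P A') (B ×P B')
  Iso-×P i j = record
    { to = Iso.to i ×N Iso.to j
    ; from = Iso.from i ×N Iso.from j
    ; to∘from = λ c (x , x') → cong₂ _,_ (Iso.to∘from i c x) (Iso.to∘from j c x')
    ; from∘to = λ c (x , x') → cong₂ _,_ (Iso.from∘to i c x) (Iso.from∘to j c x')
    }

  mem-χ : (m : Nat A B) (dm : LevelwiseDecidable m) (x : F₀ B c) (f : Hom d c) →
          mem (χ m dm x) f ≡ true ⇔ InImage m d (F₁ B f x)
  mem-χ {B = B} {d = d} m dm x f with dm d (F₁ B f x)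
  ... | yes p = mk⇔ (λ _ → p) (λ _ → refl)
  ... | no ¬p = mk⇔ (λ ()) (λ p → contradiction p ¬p)

  χ-cong : (m : Nat A B) (dm : LevelwiseDecidable m)
           (m' : Nat A' B') (dm' : LevelwiseDecidable m') {x : F₀ B c} {x' : F₀ B' c} →
           (∀ {d} (f : Hom d c) → InImage m d (F₁ B f x) ⇔ InImage m' d (F₁ B' f x')) →
           χ m dm x ≈S χ m' dm' x'
  χ-cong m dm m' dm' {x} {x'} same-image f =
    ⇔→≡ (⇔.trans (mem-χ m dm x f) (⇔.trans (same-image f) (⇔.sym (mem-χ m' dm' x' f))))

  InImage-×idN : (m : Nat A B) {x : F₀ B c} {t : F₀ K c} →
                 InImage (m ×N idN {F = K}) c (x , t) ⇔ InImage m c x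
  InImage-×idN m {t = t} =
    mk⇔ (λ ((a , _) , p) → a , ,-injectiveˡ p) (λ (a , p) → (a , t) , cong (_, t) p)

  ×idN-cofibration : {m : Nat A B} → IsCofibration Ω m → IsCofibration Ω (m ×N idN {F = K})
  ×idN-cofibration {Ω = Ω} {K = K} {m = m} cm = record
    { monic = λ c x x' p → cong₂ _,_ (monic c _ _ (,-injectiveˡ p)) (,-injectiveʳ p)
    ; decidable = decidable×
    ; classified = λ c (x , t) →
        Cof-resp Ω (χ-cong m decidable (m ×N idN {F = K}) decidable×
                           (λ f → ⇔.sym (InImage-×idN {K = K} m)))
                 (classified c x)
    }
    where
    open IsCofibration cm
    decidable× : LevelwiseDecidable (m ×N idN {F = K})
    decidable× c (x , t) = Dec.map (⇔.sym (InImage-×idN {K = K} m)) (decidable c x)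

  InImage-diag-×P : {x x' : F₀ J c} {t t' : F₀ K c} →
                    InImage (diag (J ×P K)) c ((x , t) , (x' , t')) ⇔
                    (InImage (diag J) c (x , x') × InImage (diag K) c (t , t'))
  InImage-diag-×P = mk⇔
    (λ ((x , t) , p) →
       (x , cong (λ q → proj₁ (proj₁ q) , proj₁ (proj₂ q)) p) ,
       (t , cong (λ q → proj₂ (proj₁ q) , proj₂ (proj₂ q)) p))
    (λ ((x , p) , (t , q)) →
       (x , t) , cong₂ (λ u v → (proj₁ u , proj₁ v) , (proj₂ u , proj₂ v)) p q)

  ∧-≡-true : ∀ {u v} → u ∧ v ≡ true ⇔ (u ≡ true × v ≡ true)
  ∧-≡-true = mk⇔ (λ p → ∧-conicalˡ _ _ p , ∧-conicalʳ _ _ p) (λ (p , q) → cong₂ _∧_ p q)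

  diag-×P-cofibration :
    (∀ c (S T : DecSieve {C} c) → Cof Ω c S → Cof Ω c T → Cof Ω c (S ∧S T)) →
    IsCofibration Ω (diag J) → IsCofibration Ω (diag K) → IsCofibration Ω (diag (J ×P K))
  diag-×P-cofibration {Ω = Ω} {J = J} {K = K} ∧-cof cJ cK = record
    { monic = λ c x x' p → ,-injectiveˡ p
    ; decidable = decidable×
    ; classified = λ c ((x , t) , (x' , t')) →
        Cof-resp Ω (∧S≈χ x t x' t')
          (∧-cof c _ _ (classified cJ c (x , x')) (classified cK c (t , t')))
    }
    where
    open IsCofibration
    decidable× : LevelwiseDecidable (diag (J ×P K))
    decidable× c ((x , t) , (x' , t')) =
      Dec.map (⇔.sym (InImage-diag-×P {J = J} {K = K}))
              (decidable cJ c (x , x') ×-dec decidable cK c (t , t'))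

    ∧S≈χ : (x : F₀ J c) (t : F₀ K c) (x' : F₀ J c) (t' : F₀ K c) →
           (χ (diag J) (decidable cJ) (x , x') ∧S χ (diag K) (decidable cK) (t , t'))
             ≈S χ (diag (J ×P K)) decidable× ((x , t) , (x' , t'))
    ∧S≈χ x t x' t' f = ⇔→≡
      (⇔.trans ∧-≡-true
      (⇔.trans (mem-χ (diag J) (decidable cJ) (x , x') f
                  ×-⇔ mem-χ (diag K) (decidable cK) (t , t') f)
      (⇔.trans (⇔.sym (InImage-diag-×P {J = J} {K = K}))
               (⇔.sym (mem-χ (diag (J ×P K)) decidable× ((x , t) , (x' , t')) f)))))

  HasForall : CofStructure {C} → Presheaf {C} → Set
  HasForall Ω J =
    ∀ c (Φ : CofFamily Ω J c) → Σ[ S ∈ DecSieve {C} c ] (IsForall Φ S × Cof Ω c S)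

  φ-cong : (Φ : CofFamily Ω J c) {g g' : Hom e c} {x x' : F₀ J e} →
           g ≡ g' → x ≡ x' → φ Φ g x ≈S φ Φ g' x'
  φ-cong Φ refl refl f = refl

  maximal-cong : (Φ : CofFamily Ω J c) {g g' : Hom e c} {x x' : F₀ J e} →
                 g ≡ g' → x ≡ x' → IsMaximal (φ Φ g x) → IsMaximal (φ Φ g' x')
  maximal-cong Φ refl refl max = max

  IsForall-maximal : (Φ : CofFamily Ω J c) (S : DecSieve {C} c) → IsForall Φ S →
                     IsMaximal S ⇔ (∀ {e} (g : Hom e c) x → IsMaximal (φ Φ g x))
  IsForall-maximal {c = c} Φ S ∀S = mk⇔
    (λ s {e} g x → maximal-cong Φ (identityˡ g) refl (proj₁ (∀S {c} id) s g x))
    (λ all → proj₂ (∀S {c} id) λ {e} g x → maximal-cong Φ (sym (identityˡ g)) refl (all g x))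

  IsForall-mem-≡ : (Φ : CofFamily Ω J c) (Φ' : CofFamily Ω J c')
                   (S : DecSieve {C} c) (S' : DecSieve {C} c') →
                   IsForall Φ S → IsForall Φ' S' → {f : Hom d c} {f' : Hom d c'} →
                   (∀ {e} (g : Hom e d) x → φ Φ (f ∘ g) x ≈S φ Φ' (f' ∘ g) x) →
                   mem S f ≡ mem S' f'
  IsForall-mem-≡ {d = d} Φ Φ' S S' ∀S ∀S' {f} {f'} Φ≈Φ' = ⇔→≡ (mk⇔
    (λ s → proj₂ (∀S' {d} f') λ {e} g x → trans (sym (Φ≈Φ' g x id)) (proj₁ (∀S {d} f) s g x))
    (λ s → proj₂ (∀S {d} f) λ {e} g x → trans (Φ≈Φ' g x id) (proj₁ (∀S' {d} f') s g x)))

  slice : CofFamily Ω (J ×P K) c → Hom e c → F₀ J e → CofFamily Ω K e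
  slice {J = J} {K = K} Φ g x = record
    { φ = λ h t → φ Φ (g ∘ h) (F₁ J h x , t)
    ; φ-natural = λ h' h t k →
        trans (φ-cong Φ (sym (assoc g h h')) (cong (_, F₁ K h' t) (F-∘ J h h' x)) k)
              (φ-natural Φ h' (g ∘ h) (F₁ J h x , t) k)
    ; φ-cof = λ h t → φ-cof Φ (g ∘ h) (F₁ J h x , t)
    }

  module _ (∀K : HasForall Ω K) (Φ : CofFamily Ω (J ×P K) c) where

    ∀-slice : Hom e c → F₀ J e → DecSieve {C} e
    ∀-slice {e} g x = proj₁ (∀K e (slice Φ g x))

    ∀-slice-IsForall : (g : Hom e c) (x : F₀ J e) → IsForall (slice Φ g x) (∀-slice g x)
    ∀-slice-IsForall {e} g x = proj₁ (proj₂ (∀K e (slice Φ g x)))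

    ∀-slices : CofFamily Ω J c
    ∀-slices = record
      { φ = ∀-slice
      ; φ-natural = λ h g x k →
          IsForall-mem-≡ (slice Φ (g ∘ h) (F₁ J h x)) (slice Φ g x)
            (∀-slice (g ∘ h) (F₁ J h x)) (∀-slice g x)
            (∀-slice-IsForall (g ∘ h) (F₁ J h x)) (∀-slice-IsForall g x)
            (λ g' t → φ-cong Φ (reassoc h g k g') (cong (_, t) (F₁-reassoc h k g' x)))
      ; φ-cof = λ {e} g x → proj₂ (proj₂ (∀K e (slice Φ g x)))
      }
      where
      reassoc : ∀ {e e' d d'} (h : Hom e' e) (g : Hom e c) (k : Hom d e') (g' : Hom d' d) →
                (g ∘ h) ∘ (k ∘ g') ≡ g ∘ ((h ∘ k) ∘ g')
      reassoc h g k g' = trans (assoc g h (k ∘ g')) (cong (g ∘_) (sym (assoc h k g')))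
      F₁-reassoc : ∀ {e e' d d'} (h : Hom e' e) (k : Hom d e') (g' : Hom d' d) (x : F₀ J e) →
                   F₁ J (k ∘ g') (F₁ J h x) ≡ F₁ J ((h ∘ k) ∘ g') x
      F₁-reassoc h k g' x =
        trans (sym (F-∘ J h (k ∘ g') x)) (cong (λ f → F₁ J f x) (sym (assoc h k g')))

  HasForall-×P : HasForall Ω J → HasForall Ω K → HasForall Ω (J ×P K)
  HasForall-×P {J = J} {K = K} ∀J ∀K c Φ = S , S-IsForall-Φ , proj₂ (proj₂ ∀Ψ)
    where
    ∀Ψ = ∀J c (∀-slices ∀K Φ)
    S = proj₁ ∀Ψ
    S-IsForall-Ψ = proj₁ (proj₂ ∀Ψ)

    slice-maximal : ∀ {e} (g : Hom e c) (x : F₀ J e) →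
                    IsMaximal (∀-slice ∀K Φ g x) ⇔
                    (∀ {d} (h : Hom d e) t → IsMaximal (φ Φ (g ∘ h) (F₁ J h x , t)))
    slice-maximal g x =
      IsForall-maximal (slice Φ g x) (∀-slice ∀K Φ g x) (∀-slice-IsForall ∀K Φ g x)

    S-IsForall-Φ : IsForall Φ S
    S-IsForall-Φ {d} k = to , from
      where
      to : mem S k ≡ true → ∀ {e} (g : Hom e d) xt → IsMaximal (φ Φ (k ∘ g) xt)
      to s g (x , t) =
        maximal-cong Φ (identityʳ (k ∘ g)) (cong (_, t) (F-id J x))
          (Equivalence.to (slice-maximal (k ∘ g) x) (proj₁ (S-IsForall-Ψ {d} k) s g x) id t)
      from : (∀ {e} (g : Hom e d) xt → IsMaximal (φ Φ (k ∘ g) xt)) → mem S k ≡ true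
      from all = proj₂ (S-IsForall-Ψ {d} k) λ g x → Equivalence.from (slice-maximal (k ∘ g) x)
        λ h t → maximal-cong Φ (sym (assoc k g h)) refl (all (g ∘ h) (F₁ J h x , t))

module _ {C : Category} (fp : FiniteProducts C) where
  open Category C
  open FiniteProducts fp

  ⟨⟩-∘ : ∀ {a b c d} (f : Hom c a) (g : Hom c b) (h : Hom d c) →
         ⟨ f , g ⟩ ∘ h ≡ ⟨ f ∘ h , g ∘ h ⟩
  ⟨⟩-∘ f g h = ⟨⟩-unique (f ∘ h) (g ∘ h) (⟨ f , g ⟩ ∘ h)
    (trans (sym (assoc π₁ ⟨ f , g ⟩ h)) (cong (_∘ h) (π₁-β f g)))
    (trans (sym (assoc π₂ ⟨ f , g ⟩ h)) (cong (_∘ h) (π₂-β f g)))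

  y-×ₒ : (a b : Ob) → Iso (y {C} (a ×ₒ b)) (y a ×P y b)
  y-×ₒ a b = record
    { to = record
        { η = λ d h → π₁ ∘ h , π₂ ∘ h
        ; natural = λ g h → cong₂ _,_ (sym (assoc π₁ h g)) (sym (assoc π₂ h g)) }
    ; from = record
        { η = λ d (f , g) → ⟨ f , g ⟩
        ; natural = λ h (f , g) → sym (⟨⟩-∘ f g h) }
    ; to∘from = λ d (f , g) → cong₂ _,_ (π₁-β f g) (π₂-β f g)
    ; from∘to = λ d h → sym (⟨⟩-unique (π₁ ∘ h) (π₂ ∘ h) h refl refl)
    }

  Representable-×P : {J K : Presheaf {C}} →
                     Representable J → Representable K → Representable (J ×P K)
  Representable-×P (a , y-a≅J) (b , y-b≅K) =
    a ×ₒ b , Iso-trans (y-×ₒ a b) (Iso-×P y-a≅J y-b≅K)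

module _ {C : Category} {Ω : CofStructure {C}} {Y X : Presheaf {C}} (f : Nat Y X) where

  fibration-retract : {J K : Presheaf {C}} (i : Nat J K) (r : Nat K J) → (r ∘N i) ≈N idN →
                      IsFibration K Ω f → IsFibration J Ω f
  fibration-retract {J} i r r∘i≈id fibK A B m cm z u v uv w fu fv =
    ℓ ∘N (idN ×N i) ,
    (λ c (x , t) → trans (fℓ c (x , η i c t)) (along-r∘i w c x t)) ,
    ℓz ,
    (λ c (a , t) → trans (ℓm c (a , η i c t)) (along-r∘i v c a t))
    where
    along-r∘i : ∀ {P Z} (g : Nat (P ×P J) Z) c x t →
                η g c (x , η r c (η i c t)) ≡ η g c (x , t)
    along-r∘i g c x t = cong (λ t → η g c (x , t)) (r∘i≈id c t)

    lift = fibK A B m cm (i ∘N z) u (v ∘N (idN ×N r))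
             (λ c a → trans (uv c a) (sym (along-r∘i v c a (η z c (η m c a)))))
             (w ∘N (idN ×N r))
             (λ c x → trans (fu c x) (sym (along-r∘i w c x (η z c x))))
             (λ c (a , t) → fv c (a , η r c t))
    ℓ = proj₁ lift
    fℓ = proj₁ (proj₂ lift)
    ℓz = proj₁ (proj₂ (proj₂ lift))
    ℓm = proj₂ (proj₂ (proj₂ lift))

  fibration-×P : {J K : Presheaf {C}} →
                 IsFibration J Ω f → IsFibration K Ω f → IsFibration (J ×P K) Ω f
  fibration-×P {J} {K} fibJ fibK A B m cm z u v uv w fu fv =
    ℓ₂ ∘N ⟨ ⟨ π₁N , π₂N ∘N π₂N ⟩N , π₁N ∘N π₂N ⟩N ,
    (λ c (x , s , t) → fℓ₂ c ((x , t) , s)) ,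
    (λ c x → trans (ℓ₂z c (x , η z₂ c x)) (ℓ₁z c x)) ,
    (λ c (a , s , t) → ℓ₂m c ((a , t) , s))
    where
    z₁ = π₁N ∘N z
    z₂ = π₂N ∘N z

    lift₁ = fibK A B m cm z₂ u
              (v ∘N ⟨ π₁N , ⟨ z₁ ∘N m ∘N π₁N , π₂N ⟩N ⟩N) uv
              (w ∘N ⟨ π₁N , ⟨ z₁ ∘N π₁N , π₂N ⟩N ⟩N) fu
              (λ c (a , t) → fv c (a , η z₁ c (η m c a) , t))
    ℓ₁ = proj₁ lift₁
    fℓ₁ = proj₁ (proj₂ lift₁)
    ℓ₁z = proj₁ (proj₂ (proj₂ lift₁))
    ℓ₁m = proj₂ (proj₂ (proj₂ lift₁))

    lift₂ = fibJ (A ×P K) (B ×P K) (m ×N idN) (×idN-cofibration cm) (z₁ ∘N π₁N) ℓ₁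
              (v ∘N ⟨ π₁N ∘N π₁N , ⟨ π₂N , π₂N ∘N π₁N ⟩N ⟩N) ℓ₁m
              (w ∘N ⟨ π₁N ∘N π₁N , ⟨ π₂N , π₂N ∘N π₁N ⟩N ⟩N) fℓ₁
              (λ c ((a , t) , s) → fv c (a , s , t))
    ℓ₂ = proj₁ lift₂
    fℓ₂ = proj₁ (proj₂ lift₂)
    ℓ₂z = proj₁ (proj₂ (proj₂ lift₂))
    ℓ₂m = proj₂ (proj₂ (proj₂ lift₂))

IsABCHFLSetup-×P : {C : Category} {fp : FiniteProducts C} {I I' : Presheaf {C}}
                   {p₀ p₁ : Point I} {q₀ q₁ : Point I'} {Ω : CofStructure {C}} →
                   IsABCHFLSetup C fp I p₀ p₁ Ω → IsABCHFLSetup C fp I' q₀ q₁ Ω →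
                   {r s : Point (I ×P I')} → ¬ (r ≈N s) → IsABCHFLSetup C fp (I ×P I') r s Ω
IsABCHFLSetup-×P {fp = fp} setup setup' r≉s = record
  { representable = Representable-×P fp (representable setup) (representable setup')
  ; distinct = r≉s
  ; diagonal-cof = diag-×P-cofibration (∧-cof setup) (diagonal-cof setup) (diagonal-cof setup')
  ; ⊤-cof = ⊤-cof setup
  ; ∧-cof = ∧-cof setup
  ; ⊥-cof = ⊥-cof setup
  ; ∨-cof = ∨-cof setup
  ; ∀-cof = HasForall-×P (∀-cof setup) (∀-cof setup')
  }
  where open IsABCHFLSetup

mainTheorem11 : (C : Category) (fp : FiniteProducts C) (I : Presheaf {C})
    (p₀ p₁ : Point I) (Ω : CofStructure {C}) →
    IsABCHFLSetup C fp I p₀ p₁ Ω →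
    ((r s : Point (I ×P I)) → ¬ (r ≈N s) → IsABCHFLSetup C fp (I ×P I) r s Ω)
    × ((Y X : Presheaf {C}) (f : Nat Y X) →
       IsFibration (I ×P I) Ω f ⇔ IsFibration I Ω f)
mainTheorem11 C fp I p₀ p₁ Ω setup =
  (λ r s r≉s → IsABCHFLSetup-×P setup setup r≉s) ,
  (λ Y X f → mk⇔ (fibration-retract f (diag I) π₁N (λ c x → refl))
                 (λ fibI → fibration-×P f fibI fibI))
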